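{- Let $s$ be a fixed constant, $G_B$ a boundaried graph, $T_G\subseteq V(G)$ with $|T_G|\le s$, and $S\subseteq V(G)\setminus T_G$ a set such that $G-S$ has no path between distinct vertices of $T_G$. Let $B':=S\cup(B\setminus T_G)$. Suppose $t\in T_G$ satisfies $|N_G(t)|>|B'|$, and let $X$ be a minimum-size vertex cut between $N_G(t)$ and $B'$ in $G$ (which may contain vertices of $N_G(t)$ and $B'$) that is closest to $N_G(t)$. Let $G'$ be obtained from $G$ by removing all edges incident with $t$ and adding edges between $t$ and every vertex of $X$. Then for every boundaried graph $H_B$ with $V(H)\cap V(G)=B$ and every $T_H\subseteq V(H)\setminus B$, $\mathrm{OPT}(G_B\oplus H_B,T_G\cup T_H)=\mathrm{OPT}(G'_B\oplus H_B,T_G\cup T_H)$, where $\mathrm{OPT}$ denotes the optimum of $s$-Multiway Cut.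
   Context: All graphs are finite, simple, undirected. A boundaried graph $G_B$ is a graph $G$ with $B\subseteq V(G)$; for $V(G)\cap V(H)=B$, $G_B\oplus H_B$ has vertex set $V(G)\cup V(H)$ and edge set $E(G)\cup E(H)$. $s$-Multiway Cut: given graph $G$ and $T\subseteq V(G)$, a feasible solution is $Y\subseteq V(G)\setminus T$ with $|T|\le s$ such that $G-Y$ has no path between two distinct vertices of $T$; value $|Y|$; $\mathrm{OPT}$ is the minimum value ($+\infty$ if none). A vertex cut between $P$ and $Q$ in $G$ is a set $X\subseteq V(G)$ such that $G-X$ has no path from a vertex of $P\setminus X$ to a vertex of $Q\setminus X$. A minimum $(P,Q)$-cut $X$ is closest to $P$ if $X$ is the unique minimum vertex cut between $P$ and $X$ in $G$. -}

module Defs where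

open import Data.Nat using (ℕ; _≤_; _<_)
open import Data.Bool using (Bool; true; false; _∨_; _∧_; not; if_then_else_)
open import Data.Fin using (Fin; _≟_)
open import Data.Fin.Subset using (Subset; _∈_; _∉_; _⊆_; _∪_; _∩_; _─_; ∣_∣)
open import Data.Vec using (tabulate; lookup)
open import Data.Product using (Σ; ∃; _×_)
open import Data.Sum using (_⊎_)
open import Data.Maybe using (Maybe; just; nothing)
open import Relation.Nullary using (¬_; does)
open import Relation.Binary.PropositionalEquality using (_≡_; _≢_)

record Graph (n : ℕ) : Set where
  constructor mkGraph
  field
    V : Subset n
    E : Fin n → Fin n → Bool
open Graph public

record IsSimple {n : ℕ} (G : Graph n) : Set where
  field
    sym    : ∀ u v → E G u v ≡ E G v u
    irrefl : ∀ v → E G v v ≡ false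
    closed : ∀ u v → E G u v ≡ true → u ∈ V G
open IsSimple public

N : ∀ {n} → Graph n → Fin n → Subset n
N G t = tabulate (λ v → E G t v)

data Walk {n : ℕ} (G : Graph n) (Y : Subset n) : Fin n → Fin n → Set where
  here : ∀ v → v ∈ V G → v ∉ Y → Walk G Y v v
  step : ∀ u v w → u ∈ V G → u ∉ Y → E G u v ≡ true → Walk G Y v w → Walk G Y u w

IsCut : ∀ {n} → Graph n → Subset n → Subset n → Subset n → Set
IsCut G P Q X =
  X ⊆ V G ×
  (∀ p q → p ∈ P → p ∉ X → q ∈ Q → q ∉ X → ¬ Walk G X p q)

IsMinCut : ∀ {n} → Graph n → Subset n → Subset n → Subset n → Set
IsMinCut G P Q X = IsCut G P Q X × (∀ Z → IsCut G P Q Z → ∣ X ∣ ≤ ∣ Z ∣)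

-- minimum (P,Q)-cut X closest to P: X is the unique minimum cut between P and X
IsClosestMinCut : ∀ {n} → Graph n → Subset n → Subset n → Subset n → Set
IsClosestMinCut G P Q X =
  IsMinCut G P Q X × IsMinCut G P X X × (∀ Z → IsMinCut G P X Z → Z ≡ X)

-- G_B ⊕ H_B (the condition V(G) ∩ V(H) = B is imposed in the statement)
_⊕_ : ∀ {n} → Graph n → Graph n → Graph n
G ⊕ H = mkGraph (V G ∪ V H) (λ u v → E G u v ∨ E H u v)

-- G' : delete all edges at t, add edges t–x for x ∈ X (x ≠ t, no loops)
reattach : ∀ {n} → Graph n → Fin n → Subset n → Graph n
reattach G t X = mkGraph (V G) E'
  where
  isT : _ → Bool
  isT u = does (u ≟ t)
  E' : _ → _ → Bool
  E' u v = if isT u then (not (isT v) ∧ lookup X v)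
           else (if isT v then lookup X u else E G u v)

Feasible : ∀ {n} → ℕ → Graph n → Subset n → Subset n → Set
Feasible s G T Y =
  Y ⊆ (V G ─ T) × ∣ T ∣ ≤ s ×
  (∀ a b → a ∈ T → b ∈ T → a ≢ b → ¬ Walk G Y a b)

-- OPT(G,T) = o, where o = nothing means +∞ (no feasible solution)
OptIs : ∀ {n} → ℕ → Graph n → Subset n → Maybe ℕ → Set
OptIs s G T nothing  = ∀ Y → ¬ Feasible s G T Y
OptIs s G T (just k) =
  (Σ (Subset _) λ Y → Feasible s G T Y × ∣ Y ∣ ≡ k) ×
  (∀ Y → Feasible s G T Y → k ≤ ∣ Y ∣)

-- Write P = N(t), Q = B′ and let R be the set of vertices that P reaches in G − X. Minimality of X
-- keeps every terminal out of X, and S-separation then shows that R contains no terminal except t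
-- and no vertex of B ∖ T_G ⊆ Q; so R ∖ {t} has no edge of H and R is left only through X.
-- A solution Y of G′ ⊕ H therefore solves G ⊕ H: a walk out of t through R enters X, and every
-- vertex of X is adjacent to t in G′. Conversely, for a solution Y of G ⊕ H let Xr be the vertices
-- of X that P reaches in G − Y without crossing the rest of X, and trade Y ∩ R for U = X ∖ (Y ∪ Xr).
-- Every edge of G′ ⊕ H − Y* leaving {t} ∪ R ∪ Xr starts at a vertex joined to t in G ⊕ H − Y and is
-- an edge of G ⊕ H, so Y* is a solution; and (Y ∩ R) ∪ (X ∖ U) separates P from X, so the
-- minimality of X among such cuts gives |U| ≤ |Y ∩ R| and hence |Y*| ≤ |Y|.

module Submission where

open import Defs hiding (sym)
open import Data.Nat using (ℕ; zero; suc; _+_; _≤_; _<_; z≤n; s≤s)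
open import Data.Nat.Properties
  using (≤-trans; ≤-reflexive; ≤-antisym; <⇒≱; <-≤-trans; n≤1+n;
         +-suc; +-comm; +-monoʳ-≤; +-cancelˡ-≤; module ≤-Reasoning)
open import Data.Bool as Bool using (Bool; true; false; _∨_)
open import Data.Fin as Fin using (Fin; _≟_)
open import Data.Fin.Subset using (Subset; _∈_; _∉_; _⊆_; _∪_; _∩_; _─_; _-_; ⁅_⁆; ∣_∣)
open import Data.Fin.Subset.Properties
  using (_∈?_; _⊂?_; x∈p∪q⁺; x∈p∪q⁻; x∈p∩q⁺; x∈p∩q⁻; x∈p∧x∉q⇒x∈p─q; p─q⊆p; x∈⁅x⁆; x∈⁅y⁆⇒x≡y;
         x∈p∧x≢y⇒x∈p-y; x∈p⇒∣p-x∣<∣p∣; p⊆q⇒∣p∣≤∣q∣; p⊂q⇒∣p∣<∣q∣; ∣p∣≤n)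
open import Data.Vec using ([]; _∷_; tabulate)
open import Data.Fin.Properties using (any?)
open import Data.Vec.Properties using (lookup∘tabulate; []=⇒lookup; lookup⇒[]=)
open import Data.Maybe using (Maybe; just; nothing)
open import Data.Product using (∃; ∃₂; _×_; _,_; proj₁; proj₂)
open import Data.Sum as Sum using (_⊎_; inj₁; inj₂)
open import Data.Empty using (⊥; ⊥-elim)
open import Function.Bundles using (_⇔_; mk⇔)
open import Relation.Nullary using (¬_; Dec; yes; no; does)
open import Relation.Nullary.Decidable using (dec-true; ¬?; _×-dec_; _⊎-dec_)
open import Relation.Binary.PropositionalEquality
  using (_≡_; _≢_; refl; sym; trans; cong; cong₂; subst)

-- Subsets of Fin n

x∈p─q⁻ : ∀ {n} (p q : Subset n) {x : Fin n} → x ∈ p ─ q → x ∈ p × x ∉ q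
x∈p─q⁻ (true ∷ p)  (false ∷ q) {Fin.zero}    Data.Vec.here = Data.Vec.here , λ ()
x∈p─q⁻ (_ ∷ p)     (true ∷ q)  {Fin.zero}    ()
x∈p─q⁻ (false ∷ p) (false ∷ q) {Fin.zero}    ()
x∈p─q⁻ (_ ∷ p)     (_ ∷ q)     {Fin.suc x} (Data.Vec.there x∈) with x∈p─q⁻ p q x∈
... | x∈p , x∉q = Data.Vec.there x∈p , λ { (Data.Vec.there x∈q) → x∉q x∈q }

module _ {n : ℕ} where

  x∉p∪q : {p q : Subset n} {x : Fin n} → x ∉ p → x ∉ q → x ∉ p ∪ q
  x∉p∪q {p} {q} x∉p x∉q x∈p∪q with x∈p∪q⁻ p q x∈p∪q
  ... | inj₁ x∈p = x∉p x∈p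
  ... | inj₂ x∈q = x∉q x∈q

  p⊆p-x∪⁅x⁆ : (p : Subset n) (x : Fin n) → p ⊆ (p - x) ∪ ⁅ x ⁆
  p⊆p-x∪⁅x⁆ p x {y} y∈p with y ≟ x
  ... | yes refl = x∈p∪q⁺ (inj₂ (x∈⁅x⁆ x))
  ... | no y≢x   = x∈p∪q⁺ (inj₁ (x∈p∧x≢y⇒x∈p-y y∈p y≢x))

  x∉p∪⁅y⁆⇒x≢y : {p : Subset n} {x y : Fin n} → x ∉ p ∪ ⁅ y ⁆ → x ≢ y
  x∉p∪⁅y⁆⇒x≢y {y = y} x∉ refl = x∉ (x∈p∪q⁺ (inj₂ (x∈⁅x⁆ y)))

  x∉p-x : {p : Subset n} {x : Fin n} → x ∉ p - x
  x∉p-x {p} {x} x∈p-x = proj₂ (x∈p─q⁻ p ⁅ x ⁆ x∈p-x) (x∈⁅x⁆ x)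

  ∈-tabulate⁺ : {f : Fin n → Bool} {x : Fin n} → f x ≡ true → x ∈ tabulate f
  ∈-tabulate⁺ {f} {x} fx = lookup⇒[]= x _ (trans (lookup∘tabulate f x) fx)

  ∈-tabulate⁻ : {f : Fin n → Bool} {x : Fin n} → x ∈ tabulate f → f x ≡ true
  ∈-tabulate⁻ {f} {x} x∈ = trans (sym (lookup∘tabulate f x)) ([]=⇒lookup x∈)

∣p∪q∣≤∣p∣+∣q∣ : ∀ {n} (p q : Subset n) → ∣ p ∪ q ∣ ≤ ∣ p ∣ + ∣ q ∣
∣p∪q∣≤∣p∣+∣q∣ []           []           = z≤n
∣p∪q∣≤∣p∣+∣q∣ (true ∷ p)  (true ∷ q)  =
  s≤s (≤-trans (∣p∪q∣≤∣p∣+∣q∣ p q) (≤-trans (n≤1+n _) (≤-reflexive (sym (+-suc ∣ p ∣ ∣ q ∣)))))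
∣p∪q∣≤∣p∣+∣q∣ (true ∷ p)  (false ∷ q) = s≤s (∣p∪q∣≤∣p∣+∣q∣ p q)
∣p∪q∣≤∣p∣+∣q∣ (false ∷ p) (true ∷ q)  =
  ≤-trans (s≤s (∣p∪q∣≤∣p∣+∣q∣ p q)) (≤-reflexive (sym (+-suc ∣ p ∣ ∣ q ∣)))
∣p∪q∣≤∣p∣+∣q∣ (false ∷ p) (false ∷ q) = ∣p∪q∣≤∣p∣+∣q∣ p q

∣p∣≡∣p─q∣+∣p∩q∣ : ∀ {n} (p q : Subset n) → ∣ p ∣ ≡ ∣ p ─ q ∣ + ∣ p ∩ q ∣
∣p∣≡∣p─q∣+∣p∩q∣ []           []           = refl
∣p∣≡∣p─q∣+∣p∩q∣ (true ∷ p)  (true ∷ q)  =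
  trans (cong suc (∣p∣≡∣p─q∣+∣p∩q∣ p q)) (sym (+-suc ∣ p ─ q ∣ ∣ p ∩ q ∣))
∣p∣≡∣p─q∣+∣p∩q∣ (true ∷ p)  (false ∷ q) = cong suc (∣p∣≡∣p─q∣+∣p∩q∣ p q)
∣p∣≡∣p─q∣+∣p∩q∣ (false ∷ p) (true ∷ q)  = ∣p∣≡∣p─q∣+∣p∩q∣ p q
∣p∣≡∣p─q∣+∣p∩q∣ (false ∷ p) (false ∷ q) = ∣p∣≡∣p─q∣+∣p∩q∣ p q

module _ {n : ℕ} {P : Fin n → Set} (P? : ∀ x → Dec (P x)) where

  subset : Subset n
  subset = tabulate (λ x → does (P? x))

  ∈-subset⁺ : {x : Fin n} → P x → x ∈ subset
  ∈-subset⁺ {x} px = ∈-tabulate⁺ (dec-true (P? x) px)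

  ∈-subset⁻ : {x : Fin n} → x ∈ subset → P x
  ∈-subset⁻ {x} x∈ with P? x | ∈-tabulate⁻ {x = x} x∈
  ... | yes px | _ = px
  ... | no  _  | ()

module _ {n : ℕ} (f : ℕ → Subset n) (f-mono : ∀ k → f k ⊆ f (suc k)) where

  private
    stationary-or-large : ∀ k → (∃ λ j → f (suc j) ⊆ f j) ⊎ k ≤ ∣ f k ∣
    stationary-or-large zero = inj₂ z≤n
    stationary-or-large (suc k) with stationary-or-large k | f k ⊂? f (suc k)
    ... | inj₁ found | _         = inj₁ found
    ... | inj₂ k≤    | yes f⊂f′ = inj₂ (<-≤-trans (s≤s k≤) (p⊂q⇒∣p∣<∣q∣ f⊂f′))
    ... | inj₂ _     | no  f⊄f′ = inj₁ (k , shrink)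
      where
      shrink : f (suc k) ⊆ f k
      shrink {x} x∈ with x ∈? f k
      ... | yes x∈f = x∈f
      ... | no  x∉f = ⊥-elim (f⊄f′ (f-mono k , x , x∈ , x∉f))

  chain-stabilises : ∃ λ j → f (suc j) ⊆ f j
  chain-stabilises with stationary-or-large (suc n)
  ... | inj₁ found = found
  ... | inj₂ n<   = ⊥-elim (<⇒≱ (s≤s (∣p∣≤n (f (suc n)))) n<)

-- Walks and reachability

Undirected : ∀ {n} → Graph n → Set
Undirected G = ∀ u v → E G u v ≡ E G v u

module _ {n : ℕ} {G : Graph n} where

  source∈V : {Z : Subset n} {a b : Fin n} → Walk G Z a b → a ∈ V G
  source∈V (here _ a∈V _)         = a∈V
  source∈V (step _ _ _ a∈V _ _ _) = a∈V

  source∉ : {Z : Subset n} {a b : Fin n} → Walk G Z a b → a ∉ Z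
  source∉ (here _ _ a∉Z)         = a∉Z
  source∉ (step _ _ _ _ a∉Z _ _) = a∉Z

  target∈V : {Z : Subset n} {a b : Fin n} → Walk G Z a b → b ∈ V G
  target∈V (here _ b∈V _)       = b∈V
  target∈V (step _ _ _ _ _ _ w) = target∈V w

  target∉ : {Z : Subset n} {a b : Fin n} → Walk G Z a b → b ∉ Z
  target∉ (here _ _ b∉Z)       = b∉Z
  target∉ (step _ _ _ _ _ _ w) = target∉ w

  snoc : {Z : Subset n} {a u v : Fin n} →
         Walk G Z a u → E G u v ≡ true → v ∈ V G → v ∉ Z → Walk G Z a v
  snoc (here u u∈V u∉Z)          uv v∈V v∉Z = step u _ _ u∈V u∉Z uv (here _ v∈V v∉Z)
  snoc (step a x _ a∈V a∉Z ax w) uv v∈V v∉Z = step a x _ a∈V a∉Z ax (snoc w uv v∈V v∉Z)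

  append : {Z : Subset n} {a b c : Fin n} → Walk G Z a b → Walk G Z b c → Walk G Z a c
  append (here _ _ _)                w₂ = w₂
  append (step u v _ u∈V u∉Z uv w₁) w₂ = step u v _ u∈V u∉Z uv (append w₁ w₂)

  reverse : Undirected G → {Z : Subset n} {a b : Fin n} → Walk G Z a b → Walk G Z b a
  reverse E-sym (here v v∈V v∉Z)           = here v v∈V v∉Z
  reverse E-sym (step u v _ u∈V u∉Z uv w) = snoc (reverse E-sym w) (trans (E-sym v u) uv) u∈V u∉Z

  last-exit : (D : Subset n) {Z : Subset n} {a b : Fin n} → Walk G Z a b →
              Walk G (Z ∪ D) a b ⊎ b ∈ D ⊎
              ∃₂ λ d w → d ∈ D × E G d w ≡ true × Walk G (Z ∪ D) w b
  last-exit D (here a a∈V a∉Z) with a ∈? D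
  ... | yes a∈D = inj₂ (inj₁ a∈D)
  ... | no  a∉D = inj₁ (here a a∈V (x∉p∪q a∉Z a∉D))
  last-exit D (step a v _ a∈V a∉Z av w) with last-exit D w
  ... | inj₂ later = inj₂ later
  ... | inj₁ w′ with a ∈? D
  ... | yes a∈D = inj₂ (inj₂ (a , v , a∈D , av , w′))
  ... | no  a∉D = inj₁ (step a v _ a∈V (x∉p∪q a∉Z a∉D) av w′)

  first-entry : (D : Subset n) {Z : Subset n} {a b : Fin n} → Walk G Z a b →
                Walk G (Z ∪ D) a b ⊎ a ∈ D ⊎
                ∃₂ λ w d → Walk G (Z ∪ D) a w × E G w d ≡ true × d ∈ D × Walk G Z d b
  first-entry D {a = a} w with a ∈? D
  ... | yes a∈D = inj₂ (inj₁ a∈D)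
  first-entry D (here a a∈V a∉Z) | no a∉D = inj₁ (here a a∈V (x∉p∪q a∉Z a∉D))
  first-entry D (step a v _ a∈V a∉Z av w) | no a∉D with first-entry D w
  ... | inj₁ w′ = inj₁ (step a v _ a∈V (x∉p∪q a∉Z a∉D) av w′)
  ... | inj₂ (inj₁ v∈D) = inj₂ (inj₂ (a , v , here a a∈V (x∉p∪q a∉Z a∉D) , av , v∈D , w))
  ... | inj₂ (inj₂ (u , d , w′ , ud , d∈D , w″)) =
        inj₂ (inj₂ (u , d , step a v _ a∈V (x∉p∪q a∉Z a∉D) av w′ , ud , d∈D , w″))

  avoid-unreachable : {Z D : Subset n} {a b : Fin n} →
                      (∀ {v} → Walk G Z a v → v ∉ D) → Walk G Z a b → Walk G (Z ∪ D) a b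
  avoid-unreachable never (here a a∈V a∉Z) = here a a∈V (x∉p∪q a∉Z (never (here a a∈V a∉Z)))
  avoid-unreachable never (step a v _ a∈V a∉Z av w) =
    step a v _ a∈V (x∉p∪q a∉Z (never (here a a∈V a∉Z))) av
         (avoid-unreachable (λ w′ → never (step a v _ a∈V a∉Z av w′)) w)

map-walk : ∀ {n} {G₁ G₂ : Graph n} {Z₁ Z₂ : Subset n} →
           (∀ {v} → v ∈ V G₁ → v ∉ Z₁ → v ∈ V G₂) →
           (∀ {v} → v ∈ V G₁ → v ∉ Z₁ → v ∉ Z₂) →
           (∀ {u v} → u ∉ Z₁ → v ∉ Z₁ → E G₁ u v ≡ true → E G₂ u v ≡ true) →
           ∀ {a b} → Walk G₁ Z₁ a b → Walk G₂ Z₂ a b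
map-walk on-V on-Z on-E (here v v∈V v∉Z) = here v (on-V v∈V v∉Z) (on-Z v∈V v∉Z)
map-walk on-V on-Z on-E (step u v _ u∈V u∉Z uv w) =
  step u v _ (on-V u∈V u∉Z) (on-Z u∈V u∉Z) (on-E u∉Z (source∉ w) uv) (map-walk on-V on-Z on-E w)

weaken : ∀ {n} {G : Graph n} {Z₁ Z₂ : Subset n} → Z₂ ⊆ Z₁ →
         ∀ {a b} → Walk G Z₁ a b → Walk G Z₂ a b
weaken Z₂⊆Z₁ = map-walk (λ v∈V _ → v∈V) (λ _ v∉Z₁ v∈Z₂ → v∉Z₁ (Z₂⊆Z₁ v∈Z₂)) (λ _ _ uv → uv)

module _ {n : ℕ} (G : Graph n) (Z A : Subset n) where

  Reachable : Fin n → Set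
  Reachable v = ∃ λ a → a ∈ A × Walk G Z a v

  private
    Seed : Fin n → Set
    Seed v = v ∈ A × v ∈ V G × v ∉ Z

    seed? : ∀ v → Dec (Seed v)
    seed? v = (v ∈? A) ×-dec ((v ∈? V G) ×-dec ¬? (v ∈? Z))

    Expand : Subset n → Fin n → Set
    Expand L v = v ∈ L ⊎ (v ∈ V G × v ∉ Z × ∃ λ u → u ∈ L × E G u v ≡ true)

    expand? : ∀ L v → Dec (Expand L v)
    expand? L v = (v ∈? L) ⊎-dec ((v ∈? V G) ×-dec (¬? (v ∈? Z) ×-dec
                    any? (λ u → (u ∈? L) ×-dec (E G u v Bool.≟ true))))

    -- layer k: the vertices reached from A by walks with at most k steps
    layer : ℕ → Subset n
    layer zero    = subset seed?
    layer (suc k) = subset (expand? (layer k))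

    layer-mono : ∀ k → layer k ⊆ layer (suc k)
    layer-mono k v∈ = ∈-subset⁺ (expand? (layer k)) (inj₁ v∈)

    layer-sound : ∀ k {v} → v ∈ layer k → Reachable v
    layer-sound zero v∈ with ∈-subset⁻ seed? v∈
    ... | v∈A , v∈V , v∉Z = _ , v∈A , here _ v∈V v∉Z
    layer-sound (suc k) v∈ with ∈-subset⁻ (expand? (layer k)) v∈
    ... | inj₁ v∈L = layer-sound k v∈L
    ... | inj₂ (v∈V , v∉Z , u , u∈L , uv) with layer-sound k u∈L
    ... | a , a∈A , w = a , a∈A , snoc w uv v∈V v∉Z

    seed⊆layer : ∀ k {v} → Seed v → v ∈ layer k
    seed⊆layer zero    s = ∈-subset⁺ seed? s
    seed⊆layer (suc k) s = layer-mono k (seed⊆layer k s)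

    final : ℕ
    final = proj₁ (chain-stabilises layer layer-mono)

    final-closed : ∀ {u v} → u ∈ layer final → Walk G Z u v → v ∈ layer final
    final-closed u∈ (here _ _ _)          = u∈
    final-closed u∈ (step _ _ _ _ _ uv w) =
      final-closed (proj₂ (chain-stabilises layer layer-mono)
                     (∈-subset⁺ (expand? (layer final))
                       (inj₂ (source∈V w , source∉ w , _ , u∈ , uv))))
                   w

  reachable? : ∀ v → Dec (Reachable v)
  reachable? v with v ∈? layer final
  ... | yes v∈ = yes (layer-sound final v∈)
  ... | no  v∉ = no λ { (a , a∈A , w) →
                   v∉ (final-closed (seed⊆layer final (a∈A , source∈V w , source∉ w)) w) }

-- Gluing, reattaching and optima

edge-target∈V : ∀ {n} {G : Graph n} → IsSimple G → ∀ {u v} → E G u v ≡ true → v ∈ V G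
edge-target∈V G-simple {u} {v} uv = closed G-simple v u (trans (IsSimple.sym G-simple v u) uv)

module _ {n : ℕ} {G H : Graph n} where

  ⊕-edgeˡ : {u v : Fin n} → E G u v ≡ true → E (G ⊕ H) u v ≡ true
  ⊕-edgeˡ uv rewrite uv = refl

  ⊕-edgeʳ : {u v : Fin n} → E H u v ≡ true → E (G ⊕ H) u v ≡ true
  ⊕-edgeʳ {u} {v} uv with E G u v
  ... | true  = refl
  ... | false = uv

  ⊕-edge⁻ : {u v : Fin n} → E (G ⊕ H) u v ≡ true → E G u v ≡ true ⊎ E H u v ≡ true
  ⊕-edge⁻ {u} {v} uv with E G u v
  ... | true  = inj₁ refl
  ... | false = inj₂ uv

  ⊕-undirected : Undirected G → Undirected H → Undirected (G ⊕ H)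
  ⊕-undirected G-sym H-sym u v = cong₂ _∨_ (G-sym u v) (H-sym u v)

  ⊕-simple : IsSimple G → IsSimple H → IsSimple (G ⊕ H)
  ⊕-simple G-simple H-simple = record
    { sym    = ⊕-undirected (IsSimple.sym G-simple) (IsSimple.sym H-simple)
    ; irrefl = λ v → cong₂ _∨_ (irrefl G-simple v) (irrefl H-simple v)
    ; closed = λ u v uv → x∈p∪q⁺ (Sum.map (closed G-simple u v) (closed H-simple u v) (⊕-edge⁻ uv))
    }

  ⊕-walkˡ : {Z : Subset n} {a b : Fin n} → Walk G Z a b → Walk (G ⊕ H) Z a b
  ⊕-walkˡ = map-walk (λ v∈V _ → x∈p∪q⁺ (inj₁ v∈V)) (λ _ v∉Z → v∉Z) (λ _ _ → ⊕-edgeˡ)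

module _ {n : ℕ} (G : Graph n) (t : Fin n) (X : Subset n) where

  reattach-away : {u v : Fin n} → u ≢ t → v ≢ t → E (reattach G t X) u v ≡ E G u v
  reattach-away {u} {v} u≢t v≢t with u ≟ t | v ≟ t
  ... | yes u≡t | _       = ⊥-elim (u≢t u≡t)
  ... | no _    | yes v≡t = ⊥-elim (v≢t v≡t)
  ... | no _    | no _    = refl

  reattach-at : {x : Fin n} → x ∈ X → x ≢ t → E (reattach G t X) t x ≡ true
  reattach-at {x} x∈X x≢t with t ≟ t | x ≟ t
  ... | no t≢t | _       = ⊥-elim (t≢t refl)
  ... | yes _  | yes x≡t = ⊥-elim (x≢t x≡t)
  ... | yes _  | no _    = []=⇒lookup x∈X

  reattach-at⁻ : {w : Fin n} → E (reattach G t X) t w ≡ true → w ∈ X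
  reattach-at⁻ {w} tw with t ≟ t | w ≟ t
  ... | no t≢t | _     = ⊥-elim (t≢t refl)
  reattach-at⁻ {w} () | yes _ | yes _
  ... | yes _  | no _  = lookup⇒[]= w X tw

  reattach-undirected : Undirected G → Undirected (reattach G t X)
  reattach-undirected G-sym u v with u ≟ t | v ≟ t
  ... | yes refl | yes refl = refl
  ... | yes _    | no _     = refl
  ... | no _     | yes _    = refl
  ... | no _     | no _     = G-sym u v

  module _ (H : Graph n) where

    reattach-⊕-away : {u v : Fin n} → u ≢ t → v ≢ t →
                      E (reattach G t X ⊕ H) u v ≡ E (G ⊕ H) u v
    reattach-⊕-away u≢t v≢t = cong (_∨ _) (reattach-away u≢t v≢t)

    reattach-⊕-walk : {Y : Subset n} {a b : Fin n} →
                      Walk (G ⊕ H) (Y ∪ ⁅ t ⁆) a b → Walk (reattach G t X ⊕ H) Y a b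
    reattach-⊕-walk =
      map-walk (λ v∈V _ → v∈V) (λ _ v∉ v∈Y → v∉ (x∈p∪q⁺ (inj₁ v∈Y)))
               (λ u∉ v∉ uv → trans (reattach-⊕-away (x∉p∪⁅y⁆⇒x≢y u∉) (x∉p∪⁅y⁆⇒x≢y v∉)) uv)

OptIs-⇔ : ∀ {n s} {G₁ G₂ : Graph n} {T : Subset n} →
          (∀ Y → Feasible s G₂ T Y → Feasible s G₁ T Y) →
          (∀ Y → Feasible s G₁ T Y → ∃ λ Y′ → Feasible s G₂ T Y′ × ∣ Y′ ∣ ≤ ∣ Y ∣) →
          ∀ o → OptIs s G₁ T o ⇔ OptIs s G₂ T o
OptIs-⇔ back forth nothing =
  mk⇔ (λ none Y f → none Y (back Y f)) (λ none Y f → none _ (proj₁ (proj₂ (forth Y f))))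
OptIs-⇔ {s = s} {G₁} {G₂} {T} back forth (just k) = mk⇔ to from
  where
  to : OptIs s G₁ T (just k) → OptIs s G₂ T (just k)
  to ((Y , f , ∣Y∣≡k) , k≤) with forth Y f
  ... | Y′ , f′ , ∣Y′∣≤ =
    (Y′ , f′ , ≤-antisym (≤-trans ∣Y′∣≤ (≤-reflexive ∣Y∣≡k)) (k≤ Y′ (back Y′ f′))) ,
    λ Y″ f″ → k≤ Y″ (back Y″ f″)

  from : OptIs s G₂ T (just k) → OptIs s G₁ T (just k)
  from ((Y , f , ∣Y∣≡k) , k≤) = (Y , back Y f , ∣Y∣≡k) , bound
    where
    bound : ∀ Y″ → Feasible s G₁ T Y″ → k ≤ ∣ Y″ ∣
    bound Y″ f″ with forth Y″ f″
    ... | Y′ , f′ , ∣Y′∣≤ = ≤-trans (k≤ Y′ f′) ∣Y′∣≤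

-- The region cut off by X

module ClosestCut {n : ℕ} (G : Graph n) (B TG S : Subset n) (t : Fin n) (X : Subset n)
  (G-simple : IsSimple G) (TG⊆V : TG ⊆ V G) (S⊆V─TG : S ⊆ V G ─ TG)
  (S-separates : ∀ a b → a ∈ TG → b ∈ TG → a ≢ b → ¬ Walk G S a b)
  (t∈TG : t ∈ TG) (X-closest : IsClosestMinCut G (N G t) (S ∪ (B ─ TG)) X) where

  P Q : Subset n
  P = N G t
  Q = S ∪ (B ─ TG)

  t∈V : t ∈ V G
  t∈V = TG⊆V t∈TG

  S-disjoint-TG : ∀ {v} → v ∈ S → v ∉ TG
  S-disjoint-TG v∈S = proj₂ (x∈p─q⁻ (V G) TG (S⊆V─TG v∈S))

  TG-disjoint-S : ∀ {v} → v ∈ TG → v ∉ S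
  TG-disjoint-S v∈TG v∈S = S-disjoint-TG v∈S v∈TG

  Q-disjoint-TG : ∀ {v} → v ∈ Q → v ∉ TG
  Q-disjoint-TG {v} v∈Q with x∈p∪q⁻ S (B ─ TG) v∈Q
  ... | inj₁ v∈S   = S-disjoint-TG v∈S
  ... | inj₂ v∈B─T = proj₂ (x∈p─q⁻ B TG v∈B─T)

  X⊆V : X ⊆ V G
  X⊆V = proj₁ (proj₁ (proj₁ X-closest))

  X-separates : ∀ {p q} → p ∈ P → q ∈ Q → ¬ Walk G X p q
  X-separates p∈P q∈Q w = proj₂ (proj₁ (proj₁ X-closest)) _ _ p∈P (source∉ w) q∈Q (target∉ w) w

  P-reaches-TG-only-at-t : ∀ {p v} → p ∈ P → Walk G S p v → v ∈ TG → v ≡ t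
  P-reaches-TG-only-at-t {v = v} p∈P w v∈TG with v ≟ t
  ... | yes v≡t = v≡t
  ... | no  v≢t = ⊥-elim (S-separates t v t∈TG v∈TG (λ t≡v → v≢t (sym t≡v))
                    (step t _ v t∈V (TG-disjoint-S t∈TG) (∈-tabulate⁻ p∈P) w))

  walk-from-P-avoids-Q : ∀ {p v} → p ∈ P → Walk G X p v → Walk G (X ∪ Q) p v
  walk-from-P-avoids-Q p∈P = avoid-unreachable (λ w v∈Q → X-separates p∈P v∈Q w)

  walk-from-P-avoids-S : ∀ {p v} → p ∈ P → Walk G X p v → Walk G S p v
  walk-from-P-avoids-S p∈P w =
    weaken (λ v∈S → x∈p∪q⁺ (inj₂ (x∈p∪q⁺ (inj₁ v∈S)))) (walk-from-P-avoids-Q p∈P w)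

  -- A P–Q walk avoiding X - x passes x: if x = t, the vertex after its last visit to t lies in P;
  -- otherwise its prefix up to x joins t to x in G − S.
  X-x-cut : ∀ {x} → x ∈ TG → IsCut G P Q (X - x)
  X-x-cut {x} x∈TG = (λ v∈ → X⊆V (p─q⊆p X ⁅ x ⁆ v∈)) , λ p q p∈P _ q∈Q _ → separates p∈P q∈Q
    where
    X⊆ : X ⊆ (X - x) ∪ ⁅ x ⁆
    X⊆ = p⊆p-x∪⁅x⁆ X x

    separates : ∀ {p q} → p ∈ P → q ∈ Q → ¬ Walk G (X - x) p q
    separates p∈P q∈Q w with x ≟ t
    separates p∈P q∈Q w | yes refl with last-exit ⁅ t ⁆ w
    ... | inj₁ w′ = X-separates p∈P q∈Q (weaken X⊆ w′)
    ... | inj₂ (inj₁ q∈⁅t⁆) rewrite x∈⁅y⁆⇒x≡y t q∈⁅t⁆ = Q-disjoint-TG q∈Q t∈TG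
    ... | inj₂ (inj₂ (d , _ , d∈⁅t⁆ , dv , w′)) rewrite x∈⁅y⁆⇒x≡y t d∈⁅t⁆ =
          X-separates (∈-tabulate⁺ dv) q∈Q (weaken X⊆ w′)
    separates p∈P q∈Q w | no x≢t with first-entry ⁅ x ⁆ w
    ... | inj₁ w′ = X-separates p∈P q∈Q (weaken X⊆ w′)
    ... | inj₂ (inj₁ p∈⁅x⁆) rewrite x∈⁅y⁆⇒x≡y x p∈⁅x⁆ =
          x≢t (P-reaches-TG-only-at-t p∈P (here x (TG⊆V x∈TG) (TG-disjoint-S x∈TG)) x∈TG)
    ... | inj₂ (inj₂ (_ , d , w′ , w₀d , d∈⁅x⁆ , w″)) rewrite x∈⁅y⁆⇒x≡y x d∈⁅x⁆ =
          x≢t (P-reaches-TG-only-at-t p∈P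
                 (snoc (walk-from-P-avoids-S p∈P (weaken X⊆ w′)) w₀d (source∈V w″) (TG-disjoint-S x∈TG))
                 x∈TG)

  X-disjoint-TG : ∀ {x} → x ∈ TG → x ∉ X
  X-disjoint-TG x∈TG x∈X = <⇒≱ (x∈p⇒∣p-x∣<∣p∣ x∈X) (proj₂ (proj₁ X-closest) _ (X-x-cut x∈TG))

  x∈X⇒x≢t : ∀ {x} → x ∈ X → x ≢ t
  x∈X⇒x≢t x∈X refl = X-disjoint-TG t∈TG x∈X

  R : Subset n
  R = subset (reachable? G X P)

  R⁺ : ∀ {p v} → p ∈ P → Walk G X p v → v ∈ R
  R⁺ p∈P w = ∈-subset⁺ (reachable? G X P) (_ , p∈P , w)

  R⊆V : R ⊆ V G
  R⊆V v∈R with ∈-subset⁻ (reachable? G X P) v∈R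
  ... | _ , _ , w = target∈V w

  R-disjoint-X : ∀ {v} → v ∈ R → v ∉ X
  R-disjoint-X v∈R with ∈-subset⁻ (reachable? G X P) v∈R
  ... | _ , _ , w = target∉ w

  R-disjoint-Q : ∀ {v} → v ∈ R → v ∉ Q
  R-disjoint-Q v∈R v∈Q with ∈-subset⁻ (reachable? G X P) v∈R
  ... | _ , p∈P , w = X-separates p∈P v∈Q w

  R∩TG≡t : ∀ {v} → v ∈ R → v ∈ TG → v ≡ t
  R∩TG≡t v∈R v∈TG with ∈-subset⁻ (reachable? G X P) v∈R
  ... | _ , p∈P , w = P-reaches-TG-only-at-t p∈P (walk-from-P-avoids-S p∈P w) v∈TG

  R-step : ∀ {u v} → u ∈ R → E G u v ≡ true → v ∈ R ⊎ v ∈ X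
  R-step {v = v} u∈R uv with v ∈? X
  ... | yes v∈X = inj₂ v∈X
  ... | no  v∉X with ∈-subset⁻ (reachable? G X P) u∈R
  ...   | _ , p∈P , w = inj₁ (R⁺ p∈P (snoc w uv (edge-target∈V G-simple uv) v∉X))

  P⊆R∪X : ∀ {p} → p ∈ P → p ∈ R ⊎ p ∈ X
  P⊆R∪X {p} p∈P with p ∈? X
  ... | yes p∈X = inj₂ p∈X
  ... | no  p∉X = inj₁ (R⁺ p∈P (here p (edge-target∈V G-simple (∈-tabulate⁻ p∈P)) p∉X))

  module Glued (H : Graph n) (TH : Subset n) (H-simple : IsSimple H)
               (VG∩VH≡B : V G ∩ V H ≡ B) (TH⊆VH─B : TH ⊆ V H ─ B) where

    T : Subset n
    T = TG ∪ TH

    G′ : Graph n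
    G′ = reattach G t X

    GH-simple : IsSimple (G ⊕ H)
    GH-simple = ⊕-simple G-simple H-simple

    G′H-undirected : Undirected (G′ ⊕ H)
    G′H-undirected = ⊕-undirected {G = G′} {H} (reattach-undirected G t X (IsSimple.sym G-simple))
                                               (IsSimple.sym H-simple)

    t∈T : t ∈ T
    t∈T = x∈p∪q⁺ (inj₁ t∈TG)

    t∈V⊕ : t ∈ V (G ⊕ H)
    t∈V⊕ = x∈p∪q⁺ (inj₁ t∈V)

    TH-disjoint-VG : ∀ {v} → v ∈ TH → v ∉ V G
    TH-disjoint-VG {v} v∈TH v∈VG with x∈p─q⁻ (V H) B (TH⊆VH─B v∈TH)
    ... | v∈VH , v∉B = v∉B (subst (v ∈_) VG∩VH≡B (x∈p∩q⁺ (v∈VG , v∈VH)))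

    VG∩T⊆TG : ∀ {v} → v ∈ V G → v ∈ T → v ∈ TG
    VG∩T⊆TG {v} v∈VG v∈T with x∈p∪q⁻ TG TH v∈T
    ... | inj₁ v∈TG = v∈TG
    ... | inj₂ v∈TH = ⊥-elim (TH-disjoint-VG v∈TH v∈VG)

    R∩T≡t : ∀ {v} → v ∈ R → v ∈ T → v ≡ t
    R∩T≡t v∈R v∈T = R∩TG≡t v∈R (VG∩T⊆TG (R⊆V v∈R) v∈T)

    X-disjoint-T : ∀ {v} → v ∈ X → v ∉ T
    X-disjoint-T v∈X v∈T = X-disjoint-TG (VG∩T⊆TG (X⊆V v∈X) v∈T) v∈X

    feasible⇒t∉ : ∀ {s} {K : Graph n} {Y : Subset n} → Feasible s K T Y → t ∉ Y
    feasible⇒t∉ {K = K} (Y⊆ , _) t∈Y = proj₂ (x∈p─q⁻ (V K) T (Y⊆ t∈Y)) t∈T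

    -- An H-edge at u ∈ R would put u in B ∖ TG ⊆ Q.
    R-no-H-edge : ∀ {u v} → u ∈ R → u ≢ t → E H u v ≡ true → ⊥
    R-no-H-edge {u} u∈R u≢t uv with u ∈? TG
    ... | yes u∈TG = u≢t (R∩TG≡t u∈R u∈TG)
    ... | no  u∉TG = R-disjoint-Q u∈R (x∈p∪q⁺ (inj₂ (x∈p∧x∉q⇒x∈p─q u∈B u∉TG)))
      where
      u∈B : u ∈ B
      u∈B = subst (u ∈_) VG∩VH≡B (x∈p∩q⁺ (R⊆V u∈R , closed H-simple u _ uv))

    -- Inside R a walk meets no terminal but t and uses only edges of G, so it must reach X.
    escape : ∀ {Y u c} → u ∈ R ⊎ u ∈ X → Walk (G ⊕ H) (Y ∪ ⁅ t ⁆) u c → c ∈ T →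
             ∃ λ x → x ∈ X × Walk (G′ ⊕ H) Y x c
    escape (inj₂ u∈X) w c∈T = _ , u∈X , reattach-⊕-walk G t X H w
    escape (inj₁ u∈R) (here _ _ u∉) u∈T = ⊥-elim (x∉p∪⁅y⁆⇒x≢y u∉ (R∩T≡t u∈R u∈T))
    escape (inj₁ u∈R) (step _ _ _ _ u∉ uv w) c∈T with ⊕-edge⁻ {G = G} {H} uv
    ... | inj₁ uvG = escape (R-step u∈R uvG) w c∈T
    ... | inj₂ uvH = ⊥-elim (R-no-H-edge u∈R (x∉p∪⁅y⁆⇒x≢y u∉) uvH)

    t-link : ∀ {Y w c} → t ∉ Y → E (G ⊕ H) t w ≡ true → Walk (G ⊕ H) (Y ∪ ⁅ t ⁆) w c → c ∈ T →
             Walk (G′ ⊕ H) Y t c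
    t-link t∉Y tw w c∈T with ⊕-edge⁻ {G = G} {H} tw
    ... | inj₂ twH = step t _ _ t∈V⊕ t∉Y (⊕-edgeʳ {G = G′} {H} {t} twH) (reattach-⊕-walk G t X H w)
    ... | inj₁ twG with escape (P⊆R∪X (∈-tabulate⁺ twG)) w c∈T
    ... | x , x∈X , w′ =
          step t x _ t∈V⊕ t∉Y (⊕-edgeˡ {G = G′} {H} (reattach-at G t X x∈X (x∈X⇒x≢t x∈X))) w′

    feasible-G′⊕H⇒G⊕H : ∀ {s} Y → Feasible s (G′ ⊕ H) T Y → Feasible s (G ⊕ H) T Y
    feasible-G′⊕H⇒G⊕H Y Y-feasible@(Y⊆ , ∣T∣≤s , Y-separates) = Y⊆ , ∣T∣≤s , separates
      where
      t∉Y : t ∉ Y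
      t∉Y = feasible⇒t∉ Y-feasible

      no-t-link : ∀ {w c} → E (G ⊕ H) t w ≡ true → Walk (G ⊕ H) (Y ∪ ⁅ t ⁆) w c → c ∈ T → ⊥
      no-t-link tw w c∈T =
        Y-separates t _ t∈T c∈T (λ t≡c → x∉p∪⁅y⁆⇒x≢y (target∉ w) (sym t≡c)) (t-link t∉Y tw w c∈T)

      separates : ∀ a b → a ∈ T → b ∈ T → a ≢ b → ¬ Walk (G ⊕ H) Y a b
      separates a b a∈T b∈T a≢b w with last-exit ⁅ t ⁆ w
      ... | inj₁ w′ = Y-separates a b a∈T b∈T a≢b (reattach-⊕-walk G t X H w′)
      ... | inj₂ (inj₂ (d , _ , d∈⁅t⁆ , dw , w′)) rewrite x∈⁅y⁆⇒x≡y t d∈⁅t⁆ = no-t-link dw w′ b∈T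
      ... | inj₂ (inj₁ b∈⁅t⁆) with last-exit ⁅ t ⁆ (reverse (IsSimple.sym GH-simple) w)
      ... | inj₁ w′ = source∉ w′ (x∈p∪q⁺ (inj₂ b∈⁅t⁆))
      ... | inj₂ (inj₁ a∈⁅t⁆) = a≢b (trans (x∈⁅y⁆⇒x≡y t a∈⁅t⁆) (sym (x∈⁅y⁆⇒x≡y t b∈⁅t⁆)))
      ... | inj₂ (inj₂ (d , _ , d∈⁅t⁆ , dw , w′)) rewrite x∈⁅y⁆⇒x≡y t d∈⁅t⁆ = no-t-link dw w′ a∈T

    module Rerouted {s : ℕ} (Y : Subset n) (Y-feasible : Feasible s (G ⊕ H) T Y) where

      Xr? : ∀ x → Dec (x ∈ X × Reachable G (Y ∪ (X - x)) P x)
      Xr? x = (x ∈? X) ×-dec reachable? G (Y ∪ (X - x)) P x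

      Xr U Y* Z′ : Subset n
      Xr = subset Xr?
      U  = X ─ (Y ∪ Xr)
      Y* = (Y ─ R) ∪ U
      Z′ = (Y ∩ R) ∪ (X ─ U)

      Xr⊆X : Xr ⊆ X
      Xr⊆X v∈Xr = proj₁ (∈-subset⁻ Xr? v∈Xr)

      Xr⁺ : ∀ {p x} → x ∈ X → p ∈ P → Walk G (Y ∪ (X - x)) p x → x ∈ Xr
      Xr⁺ x∈X p∈P w = ∈-subset⁺ Xr? (x∈X , _ , p∈P , w)

      U⁻ : ∀ {v} → v ∈ U → v ∉ Y × v ∉ Xr
      U⁻ {v} v∈U = (λ v∈Y → v∉Y∪Xr (x∈p∪q⁺ (inj₁ v∈Y))) , (λ v∈Xr → v∉Y∪Xr (x∈p∪q⁺ (inj₂ v∈Xr)))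
        where
        v∉Y∪Xr : v ∉ Y ∪ Xr
        v∉Y∪Xr = proj₂ (x∈p─q⁻ X (Y ∪ Xr) v∈U)

      X∖Z′⊆U : ∀ {v} → v ∈ X → v ∉ Z′ → v ∈ U
      X∖Z′⊆U {v} v∈X v∉Z′ with v ∈? U
      ... | yes v∈U = v∈U
      ... | no  v∉U = ⊥-elim (v∉Z′ (x∈p∪q⁺ (inj₂ (x∈p∧x∉q⇒x∈p─q v∈X v∉U))))

      X∖Y*⊆Xr : ∀ {v} → v ∈ X → v ∉ Y* → v ∈ Xr
      X∖Y*⊆Xr {v} v∈X v∉Y* with v ∈? Xr | v ∈? Y
      ... | yes v∈Xr | _       = v∈Xr
      ... | no  _    | yes v∈Y =
            ⊥-elim (v∉Y* (x∈p∪q⁺ (inj₁ (x∈p∧x∉q⇒x∈p─q v∈Y (λ v∈R → R-disjoint-X v∈R v∈X)))))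
      ... | no  v∉Xr | no  v∉Y =
            ⊥-elim (v∉Y* (x∈p∪q⁺ (inj₂ (x∈p∧x∉q⇒x∈p─q v∈X (x∉p∪q v∉Y v∉Xr)))))

      Z′-cut : IsCut G P X Z′
      Z′-cut = Z′⊆V , λ _ _ p∈P _ q∈X _ → separates p∈P q∈X
        where
        Z′⊆V : Z′ ⊆ V G
        Z′⊆V v∈Z′ with x∈p∪q⁻ (Y ∩ R) (X ─ U) v∈Z′
        ... | inj₁ v∈Y∩R = R⊆V (proj₂ (x∈p∩q⁻ Y R v∈Y∩R))
        ... | inj₂ v∈X─U = X⊆V (p─q⊆p X U v∈X─U)

        -- Such a walk stays in R, where avoiding Z′ means avoiding Y.
        off-Y : ∀ {p v} → p ∈ P → Walk G (Z′ ∪ X) p v → v ∉ Y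
        off-Y {v = v} p∈P w v∈Y = target∉ w (x∈p∪q⁺ (inj₁ (x∈p∪q⁺ (inj₁ (x∈p∩q⁺ (v∈Y , v∈R))))))
          where
          v∈R : v ∈ R
          v∈R = R⁺ p∈P (weaken (λ v∈X → x∈p∪q⁺ (inj₂ v∈X)) w)

        Y∪X-x⊆ : ∀ x → Y ∪ (X - x) ⊆ (Z′ ∪ X) ∪ Y
        Y∪X-x⊆ x v∈ with x∈p∪q⁻ Y (X - x) v∈
        ... | inj₁ v∈Y   = x∈p∪q⁺ (inj₂ v∈Y)
        ... | inj₂ v∈X-x = x∈p∪q⁺ (inj₁ (x∈p∪q⁺ (inj₂ (p─q⊆p X ⁅ _ ⁆ v∈X-x))))

        separates : ∀ {p q} → p ∈ P → q ∈ X → ¬ Walk G Z′ p q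
        separates p∈P q∈X w with first-entry X w
        ... | inj₁ w′ = target∉ w′ (x∈p∪q⁺ (inj₂ q∈X))
        ... | inj₂ (inj₁ p∈X) with U⁻ (X∖Z′⊆U p∈X (source∉ w))
        ...   | p∉Y , p∉Xr = p∉Xr (Xr⁺ p∈X p∈P (here _ (source∈V w) (x∉p∪q p∉Y x∉p-x)))
        separates p∈P q∈X w | inj₂ (inj₂ (_ , x , w′ , w₀x , x∈X , w″)) with U⁻ (X∖Z′⊆U x∈X (source∉ w″))
        ...   | x∉Y , x∉Xr =
                x∉Xr (Xr⁺ x∈X p∈P (snoc (weaken (Y∪X-x⊆ x) (avoid-unreachable (off-Y p∈P) w′))
                                         w₀x (source∈V w″) (x∉p∪q x∉Y x∉p-x)))

      ∣U∣≤∣Y∩R∣ : ∣ U ∣ ≤ ∣ Y ∩ R ∣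
      ∣U∣≤∣Y∩R∣ = +-cancelˡ-≤ (∣ X ─ U ∣) _ _ (begin
        ∣ X ─ U ∣ + ∣ U ∣      ≤⟨ +-monoʳ-≤ ∣ X ─ U ∣ (p⊆q⇒∣p∣≤∣q∣ U⊆X∩U) ⟩
        ∣ X ─ U ∣ + ∣ X ∩ U ∣  ≡⟨ sym (∣p∣≡∣p─q∣+∣p∩q∣ X U) ⟩
        ∣ X ∣                  ≤⟨ proj₂ (proj₁ (proj₂ X-closest)) Z′ Z′-cut ⟩
        ∣ Z′ ∣                 ≤⟨ ∣p∪q∣≤∣p∣+∣q∣ (Y ∩ R) (X ─ U) ⟩
        ∣ Y ∩ R ∣ + ∣ X ─ U ∣  ≡⟨ +-comm ∣ Y ∩ R ∣ ∣ X ─ U ∣ ⟩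
        ∣ X ─ U ∣ + ∣ Y ∩ R ∣  ∎)
        where
        open ≤-Reasoning
        U⊆X∩U : U ⊆ X ∩ U
        U⊆X∩U v∈U = x∈p∩q⁺ (p─q⊆p X (Y ∪ Xr) v∈U , v∈U)

      ∣Y*∣≤∣Y∣ : ∣ Y* ∣ ≤ ∣ Y ∣
      ∣Y*∣≤∣Y∣ = begin
        ∣ Y* ∣                 ≤⟨ ∣p∪q∣≤∣p∣+∣q∣ (Y ─ R) U ⟩
        ∣ Y ─ R ∣ + ∣ U ∣      ≤⟨ +-monoʳ-≤ ∣ Y ─ R ∣ ∣U∣≤∣Y∩R∣ ⟩
        ∣ Y ─ R ∣ + ∣ Y ∩ R ∣  ≡⟨ sym (∣p∣≡∣p─q∣+∣p∩q∣ Y R) ⟩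
        ∣ Y ∣                  ∎
        where open ≤-Reasoning

      t∉Y : t ∉ Y
      t∉Y = feasible⇒t∉ Y-feasible

      Inside : Fin n → Set
      Inside v = v ≡ t ⊎ v ∈ R ⊎ v ∈ Xr

      inside? : ∀ v → Dec (Inside v)
      inside? v = (v ≟ t) ⊎-dec ((v ∈? R) ⊎-dec (v ∈? Xr))

      inside-terminal : ∀ {v} → Inside v → v ∈ T → v ≡ t
      inside-terminal (inj₁ v≡t)         _   = v≡t
      inside-terminal (inj₂ (inj₁ v∈R))  v∈T = R∩T≡t v∈R v∈T
      inside-terminal (inj₂ (inj₂ v∈Xr)) v∈T = ⊥-elim (X-disjoint-T (Xr⊆X v∈Xr) v∈T)

      outside⇒≢t : ∀ {v} → ¬ Inside v → v ≢ t
      outside⇒≢t v-out v≡t = v-out (inj₁ v≡t)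

      outside⇒∉Y : ∀ {v} → ¬ Inside v → v ∉ Y* → v ∉ Y
      outside⇒∉Y v-out v∉Y* v∈Y =
        v∉Y* (x∈p∪q⁺ (inj₁ (x∈p∧x∉q⇒x∈p─q v∈Y (λ v∈R → v-out (inj₂ (inj₁ v∈R))))))

      away-from-t : ∀ {u w} → u ≢ t → w ≢ t → E (G′ ⊕ H) u w ≡ true → E (G ⊕ H) u w ≡ true
      away-from-t u≢t w≢t uw = trans (sym (reattach-⊕-away G t X H u≢t w≢t)) uw

      between-outside : ∀ {u w} → ¬ Inside u → ¬ Inside w → E (G′ ⊕ H) u w ≡ true → E (G ⊕ H) u w ≡ true
      between-outside u-out w-out = away-from-t (outside⇒≢t u-out) (outside⇒≢t w-out)

      t-reaches-Xr : ∀ {x} → x ∈ Xr → Walk (G ⊕ H) Y t x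
      t-reaches-Xr x∈Xr with ∈-subset⁻ Xr? x∈Xr
      ... | _ , p , p∈P , w =
            step t p _ t∈V⊕ t∉Y (⊕-edgeˡ {G = G} {H} (∈-tabulate⁻ p∈P))
                 (⊕-walkˡ (weaken (λ v∈Y → x∈p∪q⁺ (inj₁ v∈Y)) w))

      exit-at-t : ∀ {w} → ¬ Inside w → w ∉ Y* → E (G′ ⊕ H) t w ≡ true → Walk (G ⊕ H) Y t w
      exit-at-t {w} w-out w∉Y* tw with ⊕-edge⁻ {G = G′} {H} tw
      ... | inj₁ twG′ = ⊥-elim (w-out (inj₂ (inj₂ (X∖Y*⊆Xr (reattach-at⁻ G t X twG′) w∉Y*))))
      ... | inj₂ twH  =
            step t _ _ t∈V⊕ t∉Y tw′ (here _ (edge-target∈V GH-simple tw′) (outside⇒∉Y w-out w∉Y*))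
        where
        tw′ : E (G ⊕ H) t w ≡ true
        tw′ = ⊕-edgeʳ {G = G} {H} twH

      exit : ∀ {u w} → Inside u → ¬ Inside w → w ∉ Y* → E (G′ ⊕ H) u w ≡ true → Walk (G ⊕ H) Y t w
      exit (inj₁ u≡t) w-out w∉Y* uw = exit-at-t w-out w∉Y* (subst (λ z → E (G′ ⊕ H) z _ ≡ true) u≡t uw)
      exit {u} {w} (inj₂ (inj₁ u∈R)) w-out w∉Y* uw = from-R (u ≟ t)
        where
        from-R : Dec (u ≡ t) → Walk (G ⊕ H) Y t w
        from-R (yes u≡t) = exit (inj₁ u≡t) w-out w∉Y* uw
        from-R (no u≢t) with ⊕-edge⁻ {G = G} {H} (away-from-t u≢t (outside⇒≢t w-out) uw)
        ... | inj₂ uwH = ⊥-elim (R-no-H-edge u∈R u≢t uwH)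
        ... | inj₁ uwG with R-step u∈R uwG
        ...   | inj₁ w∈R = ⊥-elim (w-out (inj₂ (inj₁ w∈R)))
        ...   | inj₂ w∈X = ⊥-elim (w-out (inj₂ (inj₂ (X∖Y*⊆Xr w∈X w∉Y*))))
      exit {u} {w} (inj₂ (inj₂ u∈Xr)) w-out w∉Y* uw =
        snoc (t-reaches-Xr u∈Xr) uw′ (edge-target∈V GH-simple uw′) (outside⇒∉Y w-out w∉Y*)
        where
        uw′ : E (G ⊕ H) u w ≡ true
        uw′ = away-from-t (x∈X⇒x≢t (Xr⊆X u∈Xr)) (outside⇒≢t w-out) uw

      from-inside : ∀ {u b} → Inside u → Walk (G′ ⊕ H) Y* u b → b ∈ T → Walk (G ⊕ H) Y t b
      from-outside : ∀ {u b} → ¬ Inside u → Walk (G′ ⊕ H) Y* u b → b ∈ T →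
                     Walk (G ⊕ H) Y u b ⊎ (Walk (G ⊕ H) Y t u × Walk (G ⊕ H) Y t b)

      from-inside u-in (here _ _ _) u∈T with inside-terminal u-in u∈T
      ... | refl = here t t∈V⊕ t∉Y
      from-inside u-in (step _ w _ _ _ uw wb) b∈T with inside? w
      ... | yes w-in = from-inside w-in wb b∈T
      ... | no  w-out with from-outside w-out wb b∈T
      ...   | inj₁ wb′     = append (exit u-in w-out (source∉ wb) uw) wb′
      ...   | inj₂ (_ , tb) = tb

      from-outside u-out (here u u∈V u∉Y*) _ = inj₁ (here u u∈V (outside⇒∉Y u-out u∉Y*))
      from-outside u-out (step u w _ u∈V u∉Y* uw wb) b∈T with inside? w
      ... | yes w-in = inj₂ (exit w-in u-out u∉Y* wu , from-inside w-in wb b∈T)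
        where
        wu : E (G′ ⊕ H) w u ≡ true
        wu = trans (G′H-undirected w u) uw
      ... | no  w-out with from-outside w-out wb b∈T
      ...   | inj₁ wb′       =
              inj₁ (step u w _ u∈V (outside⇒∉Y u-out u∉Y*) (between-outside u-out w-out uw) wb′)
      ...   | inj₂ (tw , tb) =
              inj₂ (snoc tw (between-outside w-out u-out (trans (G′H-undirected w u) uw))
                         u∈V (outside⇒∉Y u-out u∉Y*) , tb)

      Y*-feasible : Feasible s (G′ ⊕ H) T Y*
      Y*-feasible = Y*⊆ , proj₁ (proj₂ Y-feasible) , separates
        where
        Y-separates : ∀ a b → a ∈ T → b ∈ T → a ≢ b → ¬ Walk (G ⊕ H) Y a b
        Y-separates = proj₂ (proj₂ Y-feasible)

        Y*⊆ : Y* ⊆ V (G′ ⊕ H) ─ T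
        Y*⊆ {v} v∈Y* with x∈p∪q⁻ (Y ─ R) U v∈Y*
        ... | inj₁ v∈Y─R = proj₁ Y-feasible (p─q⊆p Y R v∈Y─R)
        ... | inj₂ v∈U   = x∈p∧x∉q⇒x∈p─q (x∈p∪q⁺ (inj₁ (X⊆V v∈X))) (X-disjoint-T v∈X)
          where
          v∈X : v ∈ X
          v∈X = p─q⊆p X (Y ∪ Xr) v∈U

        separates : ∀ a b → a ∈ T → b ∈ T → a ≢ b → ¬ Walk (G′ ⊕ H) Y* a b
        separates a b a∈T b∈T a≢b w with inside? a
        ... | yes a-in with inside-terminal a-in a∈T
        ...   | refl = Y-separates t b t∈T b∈T a≢b (from-inside a-in w b∈T)
        separates a b a∈T b∈T a≢b w | no a-out with from-outside a-out w b∈T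
        ...   | inj₁ w′      = Y-separates a b a∈T b∈T a≢b w′
        ...   | inj₂ (ta , _) = Y-separates t a t∈T a∈T (λ t≡a → outside⇒≢t a-out (sym t≡a)) ta

lemma12 : (s n : ℕ) (G : Graph n) (B TG S : Subset n) (t : Fin n) (X : Subset n) →
    IsSimple G → B ⊆ V G →
    TG ⊆ V G → ∣ TG ∣ ≤ s →
    S ⊆ (V G ─ TG) →
    (∀ a b → a ∈ TG → b ∈ TG → a ≢ b → ¬ Walk G S a b) →
    t ∈ TG →
    ∣ S ∪ (B ─ TG) ∣ < ∣ N G t ∣ →
    IsClosestMinCut G (N G t) (S ∪ (B ─ TG)) X →
    (H : Graph n) (TH : Subset n) →
    IsSimple H → V G ∩ V H ≡ B → TH ⊆ (V H ─ B) →
    (o : Maybe ℕ) →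
    OptIs s (G ⊕ H) (TG ∪ TH) o ⇔ OptIs s (reattach G t X ⊕ H) (TG ∪ TH) o
lemma12 s n G B TG S t X G-simple _ TG⊆V _ S⊆V─TG S-separates t∈TG _ X-closest
        H TH H-simple VG∩VH≡B TH⊆VH─B =
  OptIs-⇔ feasible-G′⊕H⇒G⊕H
          (λ Y Y-feasible → Rerouted.Y* Y Y-feasible ,
                            Rerouted.Y*-feasible Y Y-feasible ,
                            Rerouted.∣Y*∣≤∣Y∣ Y Y-feasible)
  where
  open ClosestCut G B TG S t X G-simple TG⊆V S⊆V─TG S-separates t∈TG X-closest
  open Glued H TH H-simple VG∩VH≡B TH⊆VH─B
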